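{- For $\sigma\subseteq X\uplus Y\uplus\mathcal E(X,Y)$, the set $\sigma$ is a face of $\Gamma(m,n)$ if and only if there exists $\mathbf v\in\mathsf{Shuf}(m,n)$ such that $\sigma=\lambda_\downarrow(\mathbf v)$.
   Context: Fix $m,n\geq0$, $X=\{x_1,\dots,x_m\}$, $Y=\{y_1,\dots,y_n\}$, $\mathcal E(X,Y)=\{\{x,y\}:x\in X,y\in Y\}$. A shuffle word is a word over $X\cup Y$ without repeated letters in which $x_i$ precedes $x_j$ and $y_i$ precedes $y_j$ whenever both occur and $i<j$; $\mathsf{Shuf}(m,n)$ is the set of them. The bubble lattice $\mathbf{Bub}(m,n)$ orders $\mathsf{Shuf}(m,n)$ by the reflexive–transitive closure of the elementary moves $\mathbf u\to\mathbf v$: delete a letter of $X$, insert a letter of $Y$, or replace a consecutive factor $xy$ ($x\in X,y\in Y$) by $yx$. Each cover $\mathbf u\lessdot\mathbf v$ is a single such move; its label $\lambda(\mathbf u,\mathbf v)$ is $x$ if it deletes $x\in X$, $y$ if it inserts $y\in Y$, and $\{x,y\}$ if it transposes $x$ and $y$. Set $\lambda_\downarrow(\mathbf v)=\{\lambda(\mathbf u,\mathbf v):\mathbf u\lessdot\mathbf v\}$. The noncrossing matching complex $\Gamma(m,n)$ is the simplicial complex on $X\uplus Y\uplus\mathcal E(X,Y)$ whose faces are the sets $\sigma$ such that (i) each letter $x_s$ or $y_t$ occurs at most once among the elements of $\sigma$, and (ii) if $\{x_{s_1},y_{t_1}\},\{x_{s_2},y_{t_2}\}\in\sigma$ with $s_1<s_2$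 then $t_1<t_2$. -}

module Defs where

open import Data.Nat using (ℕ)
open import Data.Fin using (Fin; _<_)
open import Data.List using (List; []; _∷_; _++_)
open import Data.List.Membership.Propositional using (_∈_)
open import Data.List.Relation.Unary.Unique.Propositional using (Unique)
open import Data.Product using (Σ; ∃; _×_; _,_)
open import Data.Sum using (_⊎_)
open import Data.Bool using (Bool; T)
open import Relation.Nullary using (¬_)
open import Relation.Binary.PropositionalEquality using (_≡_; _≢_)
open import Relation.Binary.Construct.Closure.ReflexiveTransitive using (Star)

-- Letters: X = {x_1..x_m} as Fin m, Y = {y_1..y_n} as Fin n (0-indexed).
data Letter (m n : ℕ) : Set where
  xL : Fin m → Letter m n
  yL : Fin n → Letter m n

-- Elements of X ⊎ Y ⊎ E(X,Y): the vertices of Γ(m,n) / cover labels.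
data Label (m n : ℕ) : Set where
  lx : Fin m → Label m n
  ly : Fin n → Label m n
  le : Fin m → Fin n → Label m n

Word : ℕ → ℕ → Set
Word m n = List (Letter m n)

Precedes : ∀ {m n} → Letter m n → Letter m n → Word m n → Set
Precedes a b w = ∃ λ p → ∃ λ q → ∃ λ r → w ≡ p ++ a ∷ q ++ b ∷ r

record IsShuf {m n : ℕ} (w : Word m n) : Set where
  field
    unique : Unique w
    xOrd : ∀ i j → i < j → xL i ∈ w → xL j ∈ w → Precedes (xL i) (xL j) w
    yOrd : ∀ i j → i < j → yL i ∈ w → yL j ∈ w → Precedes (yL i) (yL j) w

data Step {m n : ℕ} : Word m n → Label m n → Word m n → Set where
  del  : ∀ p q i → Step (p ++ xL i ∷ q) (lx i) (p ++ q)
  ins  : ∀ p q j → Step (p ++ q) (ly j) (p ++ yL j ∷ q)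
  swap : ∀ p q i j → Step (p ++ xL i ∷ yL j ∷ q) (le i j) (p ++ yL j ∷ xL i ∷ q)

Move : ∀ {m n} → Word m n → Word m n → Set
Move u v = IsShuf u × IsShuf v × ∃ λ ℓ → Step u ℓ v

_≤B_ : ∀ {m n} → Word m n → Word m n → Set
u ≤B v = Star Move u v

_⋖_ : ∀ {m n} → Word m n → Word m n → Set
_⋖_ {m} {n} u v = u ≤B v × u ≢ v ×
  (∀ (w : Word m n) → IsShuf w → u ≤B w → w ≤B v → w ≡ u ⊎ w ≡ v)

-- ℓ ∈ λ↓(v): ℓ labels some cover u ⋖ v (the label of a cover is that of its move)
LabelDown : ∀ {m n} → Word m n → Label m n → Set
LabelDown {m} {n} v ℓ = ∃ λ (u : Word m n) → IsShuf u × u ⋖ v × Step u ℓ v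

lettersOf : ∀ {m n} → Label m n → List (Letter m n)
lettersOf (lx i) = xL i ∷ []
lettersOf (ly j) = yL j ∷ []
lettersOf (le i j) = xL i ∷ yL j ∷ []

-- σ ⊆ X ⊎ Y ⊎ E(X,Y), as a (decidable) subset of a finite set
Subset : ℕ → ℕ → Set
Subset m n = Label m n → Bool

record IsFace {m n : ℕ} (σ : Subset m n) : Set where
  field
    atMostOnce : ∀ ℓ ℓ' → T (σ ℓ) → T (σ ℓ') → ℓ ≢ ℓ' →
                 ∀ a → a ∈ lettersOf ℓ → ¬ (a ∈ lettersOf ℓ')
    noncrossing : ∀ s₁ t₁ s₂ t₂ → T (σ (le s₁ t₁)) → T (σ (le s₂ t₂)) →
                  s₁ < s₂ → t₁ < t₂

-- The set λ↓(v) can be read off v locally: lx i lies in it iff x_i is absent, ly j iff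
-- y_j occurs and is not immediately followed by an x, and le i j iff y_j x_i is a
-- factor of v. To recognise covers, attach to each word the labels it has realised
-- (x_i deleted, y_j inserted, y_j moved past x_i): every move strictly enlarges this
-- set, so a word lying between the two ends of a move has its realised set squeezed
-- between theirs, and a short case analysis forces it to be one of the ends. The face
-- conditions then follow because a letter of a repetition-free word has a unique
-- neighbour on each side and a shuffle word keeps its x's and its y's sorted.
-- Conversely a face is realised by merging the surviving x's and the needed y's in
-- increasing order, gluing each edge y_j x_i into a factor.

module Submission where

open import Defs
open import Data.Bool using (T; true; false; if_then_else_)
open import Data.Bool.Properties using (T-≡)
open import Data.Empty using (⊥; ⊥-elim)
open import Data.Unit using (⊤; tt)
open import Data.Fin using (Fin; _<_)
open import Data.Fin.Properties using (_≟_; _<?_; <-cmp; <-irrefl; <-asym; <-trans)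
open import Data.List using (List; []; _∷_; _++_; [_]; map; filter; allFin)
open import Data.List.Properties using (++-assoc; ∷-injective; ∷-injectiveˡ; ++-cancelˡ; ∷ʳ-injective)
open import Data.List.Membership.Propositional using (_∈_; _∉_; lose)
open import Data.List.Membership.Propositional.Properties using (∈-++⁻; ∈-++⁺ʳ; ∈-insert; ∈-∃++; ∈-allFin; ∈-filter⁺; ∈-filter⁻)
open import Data.List.Relation.Unary.All as All using (All; []; _∷_)
open import Data.List.Relation.Unary.All.Properties using (¬Any⇒All¬)
open import Data.List.Relation.Unary.Any using (Any; here; there; any?; satisfied)
open import Data.List.Relation.Unary.AllPairs as AllPairs using (AllPairs; []; _∷_)
open import Data.List.Relation.Unary.AllPairs.Properties as AllPairsₚ using ()
open import Data.List.Relation.Unary.Linked as Linked using (Linked; []; [-]; _∷_)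
open import Data.List.Relation.Ternary.Interleaving using (Interleaving; []; _∷ˡ_; _∷ʳ_)
open import Data.List.Relation.Unary.Unique.Propositional using (Unique)
open import Data.List.Relation.Unary.Unique.Propositional.Properties using (Unique[x∷xs]⇒x∉xs)
open import Data.Nat using (ℕ)
open import Data.Product using (∃; ∃₂; _×_; _,_; proj₁; proj₂)
open import Data.Sum using (_⊎_; inj₁; inj₂; [_,_]′)
open import Function.Base using (_∘_; id)
open import Function.Bundles using (_⇔_; mk⇔; Equivalence)
open import Function.Construct.Composition using (_⇔-∘_)
open import Function.Construct.Symmetry using (⇔-sym)
open import Relation.Binary.Definitions using (DecidableEquality; tri<; tri≈; tri>)
open import Relation.Binary.PropositionalEquality using (_≡_; _≢_; refl; sym; trans; cong; subst; subst₂)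
open import Relation.Binary.Construct.Closure.ReflexiveTransitive using (ε; _◅_)
open import Relation.Nullary using (¬_; Dec; yes; no; ¬?; does)
open import Relation.Nullary.Decidable using (T?; _×-dec_; _⊎-dec_; decidable-stable; map′)

private
  variable
    A : Set
    a b c d e : A
    p q w : List A

-- Relative position of entries in a list

data Before {A : Set} (a b : A) : List A → Set where
  here  : b ∈ w → Before a b (a ∷ w)
  there : Before a b w → Before a b (c ∷ w)

Before⇒∈ˡ : Before a b w → a ∈ w
Before⇒∈ˡ (here _)  = here refl
Before⇒∈ˡ (there r) = there (Before⇒∈ˡ r)

Before⇒∈ʳ : Before a b w → b ∈ w
Before⇒∈ʳ (here b∈w) = there b∈w
Before⇒∈ʳ (there r)  = there (Before⇒∈ʳ r)

before? : DecidableEquality A → ∀ (a b : A) w → Dec (Before a b w)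
before? _≟ᴬ_ a b [] = no λ ()
before? _≟ᴬ_ a b (c ∷ w) with before? _≟ᴬ_ a b w | a ≟ᴬ c
... | yes r  | _        = yes (there r)
... | no ¬r  | no a≢c   = no λ { (here _) → a≢c refl ; (there r) → ¬r r }
... | no ¬r  | yes refl with any? (b ≟ᴬ_) w
...   | yes b∈w = yes (here b∈w)
...   | no b∉w  = no λ { (here b∈w) → b∉w b∈w ; (there r) → ¬r r }

Precedes⇒Before : Precedes a b w → Before a b w
Precedes⇒Before {a = a} {b = b} (p , q , r , refl) = go p
  where
  go : ∀ p → Before a b (p ++ a ∷ q ++ b ∷ r)
  go []      = here (∈-insert q)
  go (_ ∷ p) = there (go p)

Before⇒Precedes : Before a b w → Precedes a b w
Before⇒Precedes (here b∈w) with ∈-∃++ b∈w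
... | q , r , refl = [] , q , r , refl
Before⇒Precedes (there r) with Before⇒Precedes r
... | p , q , r′ , refl = _ ∷ p , q , r′ , refl

∈-addMiddle : ∀ p → a ∈ p ++ q → a ∈ p ++ c ∷ q
∈-addMiddle []      a∈       = there a∈
∈-addMiddle (_ ∷ p) (here e) = here e
∈-addMiddle (_ ∷ p) (there a∈) = there (∈-addMiddle p a∈)

∈-middle⁻ : ∀ p → a ∈ p ++ c ∷ q → a ≡ c ⊎ a ∈ p ++ q
∈-middle⁻ []      (here e)   = inj₁ e
∈-middle⁻ []      (there a∈) = inj₂ a∈
∈-middle⁻ (_ ∷ p) (here e)   = inj₂ (here e)
∈-middle⁻ (_ ∷ p) (there a∈) with ∈-middle⁻ p a∈
... | inj₁ e   = inj₁ e
... | inj₂ a∈′ = inj₂ (there a∈′)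

∈-dropMiddle : ∀ p → a ≢ c → a ∈ p ++ c ∷ q → a ∈ p ++ q
∈-dropMiddle p a≢c a∈ = [ ⊥-elim ∘ a≢c , id ]′ (∈-middle⁻ p a∈)

∈-swapMiddle : ∀ p → a ∈ p ++ c ∷ d ∷ q → a ∈ p ++ d ∷ c ∷ q
∈-swapMiddle []      (here e)           = there (here e)
∈-swapMiddle []      (there (here e))   = here e
∈-swapMiddle []      (there (there a∈)) = there (there a∈)
∈-swapMiddle (_ ∷ p) (here e)           = here e
∈-swapMiddle (_ ∷ p) (there a∈)         = there (∈-swapMiddle p a∈)

Before-addMiddle : ∀ p → Before a b (p ++ q) → Before a b (p ++ c ∷ q)
Before-addMiddle []      r          = there r
Before-addMiddle (_ ∷ p) (here b∈)  = here (∈-addMiddle p b∈)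
Before-addMiddle (_ ∷ p) (there r)  = there (Before-addMiddle p r)

Before-dropMiddle : ∀ p → a ≢ c → b ≢ c → Before a b (p ++ c ∷ q) → Before a b (p ++ q)
Before-dropMiddle []      a≢c _   (here _)  = ⊥-elim (a≢c refl)
Before-dropMiddle []      _   _   (there r) = r
Before-dropMiddle (_ ∷ p) _   b≢c (here b∈) = here (∈-dropMiddle p b≢c b∈)
Before-dropMiddle (_ ∷ p) a≢c b≢c (there r) = there (Before-dropMiddle p a≢c b≢c r)

Before-swapMiddle : ∀ p → ¬ (a ≡ c × b ≡ d) → Before a b (p ++ c ∷ d ∷ q) → Before a b (p ++ d ∷ c ∷ q)
Before-swapMiddle [] ¬cd (here (here b≡d)) = ⊥-elim (¬cd (refl , b≡d))
Before-swapMiddle [] _   (here (there b∈)) = there (here b∈)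
Before-swapMiddle [] _   (there (here b∈)) = here (there b∈)
Before-swapMiddle [] _   (there (there r)) = there (there r)
Before-swapMiddle (_ ∷ p) _   (here b∈) = here (∈-swapMiddle p b∈)
Before-swapMiddle (_ ∷ p) ¬cd (there r) = there (Before-swapMiddle p ¬cd r)

Before-middle : ∀ p → b ∈ q → Before c b (p ++ c ∷ q)
Before-middle []      b∈ = here b∈
Before-middle (_ ∷ p) b∈ = there (Before-middle p b∈)

Before-middleˡ : ∀ p → a ∈ p → Before a c (p ++ c ∷ q)
Before-middleˡ (_ ∷ p) (here refl) = here (∈-insert p)
Before-middleˡ (_ ∷ p) (there a∈)  = there (Before-middleˡ p a∈)

Before-irrefl : Unique w → ¬ Before a a w
Before-irrefl u@(_ ∷ _) (here a∈) = Unique[x∷xs]⇒x∉xs u a∈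
Before-irrefl (_ ∷ u)  (there r) = Before-irrefl u r

Before-asym : Unique w → Before a b w → ¬ Before b a w
Before-asym u@(_ ∷ _) (here b∈) (here a∈) = Unique[x∷xs]⇒x∉xs u a∈
Before-asym u@(_ ∷ _) (here _)  (there r) = Unique[x∷xs]⇒x∉xs u (Before⇒∈ʳ r)
Before-asym u@(_ ∷ _) (there r) (here _)  = Unique[x∷xs]⇒x∉xs u (Before⇒∈ʳ r)
Before-asym (_ ∷ u)   (there r) (there s) = Before-asym u r s

Before-trans : Unique w → Before a b w → Before b d w → Before a d w
Before-trans _         (here _)  (here d∈) = here d∈
Before-trans _         (here _)  (there s) = here (Before⇒∈ʳ s)
Before-trans u@(_ ∷ _) (there r) (here _)  = ⊥-elim (Unique[x∷xs]⇒x∉xs u (Before⇒∈ʳ r))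
Before-trans (_ ∷ u)   (there r) (there s) = there (Before-trans u r s)

Unique-middle-∉ : ∀ p → Unique (p ++ c ∷ q) → c ∉ p ++ q
Unique-middle-∉ []      u             c∈ = Unique[x∷xs]⇒x∉xs u c∈
Unique-middle-∉ (_ ∷ p) (x≢ ∷ _)     (here refl) = All.lookup x≢ (∈-insert p) refl
Unique-middle-∉ (_ ∷ p) (_ ∷ u)      (there c∈)  = Unique-middle-∉ p u c∈

Before-middle⁻ : ∀ p → Unique (p ++ c ∷ q) → Before c b (p ++ c ∷ q) → b ∈ q
Before-middle⁻ []      _         (here b∈) = b∈
Before-middle⁻ []      u         (there r) = ⊥-elim (Unique[x∷xs]⇒x∉xs u (Before⇒∈ˡ r))
Before-middle⁻ (_ ∷ p) u@(_ ∷ _) (here _)  = ⊥-elim (Unique[x∷xs]⇒x∉xs u (∈-insert p))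
Before-middle⁻ (_ ∷ p) (_ ∷ u)   (there r) = Before-middle⁻ p u r

Unique-dropMiddle : ∀ p → Unique (p ++ c ∷ q) → Unique (p ++ q)
Unique-dropMiddle []      (_ ∷ u)  = u
Unique-dropMiddle (_ ∷ p) (x≢ ∷ u) = All.tabulate (All.lookup x≢ ∘ ∈-addMiddle p) ∷ Unique-dropMiddle p u

Unique-addMiddle : ∀ p → c ∉ p ++ q → Unique (p ++ q) → Unique (p ++ c ∷ q)
Unique-addMiddle []      c∉ u        = ¬Any⇒All¬ _ c∉ ∷ u
Unique-addMiddle (_ ∷ p) c∉ (x≢ ∷ u) =
  All.tabulate (λ a∈ → [ (λ { refl e → c∉ (here (sym e)) }) , All.lookup x≢ ]′ (∈-middle⁻ p a∈))
  ∷ Unique-addMiddle p (c∉ ∘ there) u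

Unique-swapMiddle : ∀ p → Unique (p ++ c ∷ d ∷ q) → Unique (p ++ d ∷ c ∷ q)
Unique-swapMiddle []      ((c≢d ∷ c≢) ∷ d≢ ∷ u) = ((c≢d ∘ sym) ∷ d≢) ∷ c≢ ∷ u
Unique-swapMiddle (_ ∷ p) (x≢ ∷ u) =
  All.tabulate (All.lookup x≢ ∘ ∈-swapMiddle p) ∷ Unique-swapMiddle p u

unique-split : ∀ p p′ {q q′ : List A} → Unique w → w ≡ p ++ c ∷ q → w ≡ p′ ++ c ∷ q′ → p ≡ p′ × q ≡ q′
unique-split []      []       _         refl e = refl , proj₂ (∷-injective e)
unique-split []      (_ ∷ p′) u         refl e with ∷-injective e
... | refl , refl = ⊥-elim (Unique[x∷xs]⇒x∉xs u (∈-insert p′))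
unique-split (_ ∷ p) []       u         refl e with ∷-injective e
... | refl , _ = ⊥-elim (Unique[x∷xs]⇒x∉xs u (∈-insert p))
unique-split (_ ∷ p) (_ ∷ p′) (_ ∷ u)   refl e with ∷-injective e
... | refl , e′ with unique-split p p′ u refl e′
...   | refl , refl = refl , refl

Adjacent : A → A → List A → Set
Adjacent c d w = ∃₂ λ p q → w ≡ p ++ c ∷ d ∷ q

Adjacent⇒Before : Adjacent c d w → Before c d w
Adjacent⇒Before (p , _ , refl) = Before-middle p (here refl)

Before-adjacent : Unique w → Adjacent c d w → e ≢ c → Before e d w → Before e c w
Before-adjacent u (p , _ , refl) = go p u
  where
  go : ∀ p → Unique (p ++ c ∷ d ∷ q) → e ≢ c → Before e d (p ++ c ∷ d ∷ q) → Before e c (p ++ c ∷ d ∷ q)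
  go []      _        e≢c (here _)          = ⊥-elim (e≢c refl)
  go []      (_ ∷ ud) _   (there (here d∈)) = ⊥-elim (Unique[x∷xs]⇒x∉xs ud d∈)
  go []      (_ ∷ ud) _   (there (there r)) = ⊥-elim (Unique[x∷xs]⇒x∉xs ud (Before⇒∈ʳ r))
  go (_ ∷ p) _        _   (here _)          = here (∈-insert p)
  go (_ ∷ p) (_ ∷ u)  e≢c (there r)         = there (go p u e≢c r)

Adjacent-successor : Unique w → Adjacent c a w → Adjacent c b w → a ≡ b
Adjacent-successor u (p , _ , e) (p′ , _ , e′) = ∷-injectiveˡ (proj₂ (unique-split p p′ u e e′))

Adjacent-predecessor : Unique w → Adjacent a c w → Adjacent b c w → a ≡ b
Adjacent-predecessor {a = a} {c = c} {b = b} u (p , q , e) (p′ , q′ , e′) =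
  proj₂ (∷ʳ-injective p p′ (proj₁ (unique-split (p ++ [ a ]) (p′ ++ [ b ]) u
    (trans e (sym (++-assoc p [ a ] (c ∷ q)))) (trans e′ (sym (++-assoc p′ [ b ] (c ∷ q′)))))))

Adjacent-there : Adjacent c d w → Adjacent c d (a ∷ w)
Adjacent-there (p , q , e) = _ ∷ p , q , cong (_ ∷_) e

Linked-adjacent : ∀ {R : A → A → Set} → Linked R w → Adjacent c d w → R c d
Linked-adjacent {R = R} l (p , q , refl) = go p l
  where
  go : ∀ p → Linked R (p ++ c ∷ d ∷ q) → R c d
  go []      l = Linked.head l
  go (_ ∷ p) l = go p (Linked.tail l)

-- Proofs about FaceWord.merge recurse through this eliminator: the same recursion under
-- `with` on merge's branches is not recognised as terminating.
List-ind₂ : ∀ {B : Set} (P : List A → List B → Set) →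
            (∀ ys → P [] ys) →
            (∀ {x xs} → P xs [] → P (x ∷ xs) []) →
            (∀ {x xs y ys} → P xs ys → P (x ∷ xs) ys → P xs (y ∷ ys) → P (x ∷ xs) (y ∷ ys)) →
            ∀ xs ys → P xs ys
List-ind₂ P nil cons-nil step []       ys       = nil ys
List-ind₂ P nil cons-nil step (x ∷ xs) []       = cons-nil (List-ind₂ P nil cons-nil step xs [])
List-ind₂ P nil cons-nil step (x ∷ xs) (y ∷ ys) =
  step (List-ind₂ P nil cons-nil step xs ys) (List-ind₂ P nil cons-nil step (x ∷ xs) ys)
       (List-ind₂ P nil cons-nil step xs (y ∷ ys))

-- Shuffle words

private
  variable
    m n : ℕ
    i i′ : Fin m
    j j′ : Fin n
    u v : Word m n
    ℓ ℓ′ : Label m n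
    σ : Subset m n

xL-injective : xL {n = n} i ≡ xL i′ → i ≡ i′
xL-injective refl = refl

yL-injective : yL {m = m} j ≡ yL j′ → j ≡ j′
yL-injective refl = refl

_≟ₗ_ : DecidableEquality (Letter m n)
xL i ≟ₗ xL i′ = map′ (cong xL) xL-injective (i ≟ i′)
xL _ ≟ₗ yL _  = no λ ()
yL _ ≟ₗ xL _  = no λ ()
yL j ≟ₗ yL j′ = map′ (cong yL) yL-injective (j ≟ j′)

_∈?_ : ∀ (a : Letter m n) w → Dec (a ∈ w)
a ∈? w = any? (a ≟ₗ_) w

_⊏_ : Letter m n → Letter m n → Set
xL i ⊏ xL i′ = i < i′
yL j ⊏ yL j′ = j < j′
_    ⊏ _     = ⊥

IsShuf-ordered : IsShuf w → a ⊏ b → a ∈ w → b ∈ w → Before a b w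
IsShuf-ordered {a = xL i} {b = xL i′} s i<i′ a∈ b∈ = Precedes⇒Before (IsShuf.xOrd s i i′ i<i′ a∈ b∈)
IsShuf-ordered {a = yL j} {b = yL j′} s j<j′ a∈ b∈ = Precedes⇒Before (IsShuf.yOrd s j j′ j<j′ a∈ b∈)
IsShuf-ordered {a = xL _} {b = yL _} _ ()
IsShuf-ordered {a = yL _} {b = xL _} _ ()

mkIsShuf : Unique w → (∀ {a b} → a ⊏ b → a ∈ w → b ∈ w → Before a b w) → IsShuf w
mkIsShuf u ordered = record
  { unique = u
  ; xOrd   = λ _ _ lt a∈ b∈ → Before⇒Precedes (ordered lt a∈ b∈)
  ; yOrd   = λ _ _ lt a∈ b∈ → Before⇒Precedes (ordered lt a∈ b∈)
  }

Before-unordered : IsShuf w → b ⊏ a → ¬ Before a b w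
Before-unordered s b⊏a r = Before-asym (IsShuf.unique s) r (IsShuf-ordered s b⊏a (Before⇒∈ʳ r) (Before⇒∈ˡ r))

x-Before⇒< : IsShuf w → Before (xL i) (xL i′) w → i < i′
x-Before⇒< {i = i} {i′ = i′} s r with <-cmp i i′
... | tri< i<i′ _ _ = i<i′
... | tri≈ _ refl _ = ⊥-elim (Before-irrefl (IsShuf.unique s) r)
... | tri> _ _ i′<i = ⊥-elim (Before-unordered s i′<i r)

y-Before⇒< : IsShuf w → Before (yL j) (yL j′) w → j < j′
y-Before⇒< {j = j} {j′ = j′} s r with <-cmp j j′
... | tri< j<j′ _ _ = j<j′
... | tri≈ _ refl _ = ⊥-elim (Before-irrefl (IsShuf.unique s) r)
... | tri> _ _ j′<j = ⊥-elim (Before-unordered s j′<j r)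

IsShuf-dropMiddle : ∀ p → IsShuf (p ++ c ∷ q) → IsShuf (p ++ q)
IsShuf-dropMiddle {c = c} {q = q} p s =
  mkIsShuf (Unique-dropMiddle p (IsShuf.unique s)) λ a⊏b a∈ b∈ →
    Before-dropMiddle p (≢c a∈) (≢c b∈) (IsShuf-ordered s a⊏b (∈-addMiddle p a∈) (∈-addMiddle p b∈))
  where
  ≢c : a ∈ p ++ q → a ≢ c
  ≢c a∈ refl = Unique-middle-∉ p (IsShuf.unique s) a∈

IsShuf-swapMiddle : ∀ p → ¬ c ⊏ d → IsShuf (p ++ c ∷ d ∷ q) → IsShuf (p ++ d ∷ c ∷ q)
IsShuf-swapMiddle p c⋢d s =
  mkIsShuf (Unique-swapMiddle p (IsShuf.unique s)) λ a⊏b a∈ b∈ →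
    Before-swapMiddle p (λ { (refl , refl) → c⋢d a⊏b })
      (IsShuf-ordered s a⊏b (∈-swapMiddle p a∈) (∈-swapMiddle p b∈))

-- Realised labels and covers

-- The labels w has already performed: x_i deleted, y_j inserted, y_j moved past x_i.
-- A move realises its own label and keeps the others, so realised sets strictly grow
-- along the bubble order.
Realised : Label m n → Word m n → Set
Realised (lx i)   w = xL i ∉ w
Realised (ly j)   w = yL j ∈ w
Realised (le i j) w = yL j ∈ w × ¬ Before (xL i) (yL j) w

realised? : ∀ (ℓ : Label m n) w → Dec (Realised ℓ w)
realised? (lx i)   w = ¬? (xL i ∈? w)
realised? (ly j)   w = yL j ∈? w
realised? (le i j) w = (yL j ∈? w) ×-dec ¬? (before? _≟ₗ_ (xL i) (yL j) w)

_⊑_ : Word m n → Word m n → Set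
u ⊑ w = ∀ ℓ → Realised ℓ u → Realised ℓ w

step-⊑ : Unique v → Step u ℓ v → u ⊑ v
step-⊑ _ (del p q i) (lx _)   x∉       = x∉ ∘ ∈-addMiddle p
step-⊑ _ (del p q i) (ly _)   y∈       = ∈-dropMiddle p (λ ()) y∈
step-⊑ _ (del p q i) (le _ _) (y∈ , ¬b) = ∈-dropMiddle p (λ ()) y∈ , ¬b ∘ Before-addMiddle p
step-⊑ _ (ins p q j) (lx _)   x∉       = x∉ ∘ ∈-dropMiddle p (λ ())
step-⊑ _ (ins p q j) (ly _)   y∈       = ∈-addMiddle p y∈
step-⊑ uv (ins p q j) (le _ _) (y∈ , ¬b) =
  ∈-addMiddle p y∈ , ¬b ∘ Before-dropMiddle p (λ ()) λ { refl → Unique-middle-∉ p uv y∈ }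
step-⊑ _ (swap p q i j) (lx _)   x∉       = x∉ ∘ ∈-swapMiddle p
step-⊑ _ (swap p q i j) (ly _)   y∈       = ∈-swapMiddle p y∈
step-⊑ _ (swap p q i j) (le _ _) (y∈ , ¬b) = ∈-swapMiddle p y∈ , ¬b ∘ Before-swapMiddle p λ { (() , _) }

step-realises : Unique u → Unique v → Step u ℓ v → ¬ Realised ℓ u × Realised ℓ v
step-realises uu _  (del p q i)    = (λ x∉ → x∉ (∈-insert p)) , Unique-middle-∉ p uu
step-realises _  uv (ins p q j)    = Unique-middle-∉ p uv , ∈-insert p
step-realises _  uv (swap p q i j) =
  (λ (_ , ¬b) → ¬b (Before-middle p (here refl))) ,
  (∈-insert p , λ b → Before-asym uv b (Before-middle p (here refl)))

≤B⇒⊑ : u ≤B v → u ⊑ v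
≤B⇒⊑ ε                        _ r = r
≤B⇒⊑ ((_ , sv , _ , st) ◅ ms) ℓ r = ≤B⇒⊑ ms ℓ (step-⊑ (IsShuf.unique sv) st ℓ r)

≤B-⊒⇒≡ : u ≤B v → v ⊑ u → u ≡ v
≤B-⊒⇒≡ ε _ = refl
≤B-⊒⇒≡ ((su , sv , ℓ , st) ◅ ms) v⊑u with step-realises (IsShuf.unique su) (IsShuf.unique sv) st
... | ¬ru , rv = ⊥-elim (¬ru (v⊑u ℓ (≤B⇒⊑ ms ℓ rv)))

step⇒⋖ : IsShuf u → IsShuf v → Step u ℓ v →
         (∀ w → IsShuf w → u ⊑ w → w ⊑ v → w ⊑ u ⊎ v ⊑ w) → u ⋖ v
step⇒⋖ {u = u} {v = v} {ℓ = ℓ} su sv st squeeze = (su , sv , ℓ , st) ◅ ε , u≢v , between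
  where
  u≢v : u ≢ v
  u≢v refl with step-realises (IsShuf.unique su) (IsShuf.unique sv) st
  ... | ¬ru , rv = ¬ru rv
  between : ∀ w → IsShuf w → u ≤B w → w ≤B v → w ≡ u ⊎ w ≡ v
  between w sw u≤w w≤v with squeeze w sw (≤B⇒⊑ u≤w) (≤B⇒⊑ w≤v)
  ... | inj₁ w⊑u = inj₁ (sym (≤B-⊒⇒≡ u≤w w⊑u))
  ... | inj₂ v⊑w = inj₂ (≤B-⊒⇒≡ w≤v v⊑w)

swap-realised : ∀ p ℓ → Realised ℓ (p ++ yL j ∷ xL i ∷ q) →
                ℓ ≡ le i j ⊎ Realised ℓ (p ++ xL i ∷ yL j ∷ q)
swap-realised p (lx _)     x∉ = inj₂ (x∉ ∘ ∈-swapMiddle p)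
swap-realised p (ly _)     y∈ = inj₂ (∈-swapMiddle p y∈)
swap-realised {j = j} {i = i} p (le i′ j′) (y∈ , ¬b) with i′ ≟ i | j′ ≟ j
... | yes refl | yes refl = inj₁ refl
... | no i′≢i  | _        = inj₂ (∈-swapMiddle p y∈ , ¬b ∘ Before-swapMiddle p λ (e , _) → i′≢i (xL-injective e))
... | _        | no j′≢j  = inj₂ (∈-swapMiddle p y∈ , ¬b ∘ Before-swapMiddle p λ (_ , e) → j′≢j (yL-injective e))

swap-⋖ : ∀ p → IsShuf (p ++ xL i ∷ yL j ∷ q) → IsShuf (p ++ yL j ∷ xL i ∷ q) →
         (p ++ xL i ∷ yL j ∷ q) ⋖ (p ++ yL j ∷ xL i ∷ q)
swap-⋖ {i = i} {j = j} {q = q} p su sv = step⇒⋖ su sv (swap p q i j) squeeze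
  where
  back : ∀ ℓ → Realised ℓ (p ++ yL j ∷ xL i ∷ q) → ℓ ≡ le i j ⊎ Realised ℓ (p ++ xL i ∷ yL j ∷ q)
  back = swap-realised p
  squeeze : ∀ w → IsShuf w → (p ++ xL i ∷ yL j ∷ q) ⊑ w → w ⊑ (p ++ yL j ∷ xL i ∷ q) →
            w ⊑ (p ++ xL i ∷ yL j ∷ q) ⊎ (p ++ yL j ∷ xL i ∷ q) ⊑ w
  squeeze w _ u⊑w w⊑v with realised? (le i j) w
  ... | yes r = inj₂ λ ℓ rv → [ (λ { refl → r }) , u⊑w ℓ ]′ (back ℓ rv)
  ... | no ¬r = inj₁ λ ℓ rw → [ (λ { refl → ⊥-elim (¬r rw) }) , id ]′ (back ℓ (w⊑v ℓ rw))

data XView {m n} (i : Fin m) : Label m n → Set where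
  at-x    : XView i (lx i)
  at-edge : ∀ j → XView i (le i j)
  away    : ∀ {ℓ} → xL i ∉ lettersOf ℓ → XView i ℓ

xView : ∀ i (ℓ : Label m n) → XView i ℓ
xView i (lx i′) with i′ ≟ i
... | yes refl = at-x
... | no i′≢i  = away λ { (here e) → i′≢i (sym (xL-injective e)) ; (there ()) }
xView i (ly j) = away λ { (here ()) ; (there ()) }
xView i (le i′ j) with i′ ≟ i
... | yes refl = at-edge j
... | no i′≢i  = away λ { (here e) → i′≢i (sym (xL-injective e)) ; (there (here ())) ; (there (there ())) }

data YView {m n} (j : Fin n) : Label m n → Set where
  at-y    : YView j (ly j)
  at-edge : ∀ i → YView j (le i j)
  away    : ∀ {ℓ} → yL j ∉ lettersOf ℓ → YView j ℓ

yView : ∀ j (ℓ : Label m n) → YView j ℓ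
yView j (lx i) = away λ { (here ()) ; (there ()) }
yView j (ly j′) with j′ ≟ j
... | yes refl = at-y
... | no j′≢j  = away λ { (here e) → j′≢j (sym (yL-injective e)) ; (there ()) }
yView j (le i j′) with j′ ≟ j
... | yes refl = at-edge i
... | no j′≢j  = away λ { (here ()) ; (there (here e)) → j′≢j (sym (yL-injective e)) ; (there (there ())) }

Realised-addMiddle : ∀ p ℓ → c ∉ lettersOf ℓ → Realised ℓ (p ++ q) ⇔ Realised ℓ (p ++ c ∷ q)
Realised-addMiddle p (lx i) c∉ =
  mk⇔ (λ x∉ → x∉ ∘ ∈-dropMiddle p λ { refl → c∉ (here refl) }) (λ x∉ → x∉ ∘ ∈-addMiddle p)
Realised-addMiddle p (ly j) c∉ =
  mk⇔ (∈-addMiddle p) (∈-dropMiddle p λ { refl → c∉ (here refl) })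
Realised-addMiddle p (le i j) c∉ = mk⇔
  (λ (y∈ , ¬b) → ∈-addMiddle p y∈ , ¬b ∘ Before-dropMiddle p x≢c y≢c)
  (λ (y∈ , ¬b) → ∈-dropMiddle p y≢c y∈ , ¬b ∘ Before-addMiddle p)
  where
  x≢c : xL i ≢ _
  x≢c refl = c∉ (here refl)
  y≢c : yL j ≢ _
  y≢c refl = c∉ (there (here refl))

NotXHeaded : Word m n → Set
NotXHeaded (xL _ ∷ _) = ⊥
NotXHeaded _          = ⊤

NotYHeaded : Word m n → Set
NotYHeaded (yL _ ∷ _) = ⊥
NotYHeaded _          = ⊤

-- In w, x_i precedes the letter x_{i₂} following it in u, which precedes y_j as in v.
delete-keeps-order : ∀ p → IsShuf (p ++ xL i ∷ q) → NotYHeaded q → IsShuf w → w ⊑ (p ++ q) →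
                     xL i ∈ w → yL j ∈ w → Before (xL i) (yL j) (p ++ xL i ∷ q) → Before (xL i) (yL j) w
delete-keeps-order {q = []} p su _ _ _ _ _ b with Before-middle⁻ p (IsShuf.unique su) b
... | ()
delete-keeps-order {q = yL _ ∷ _} p _ () _ _ _ _ _
delete-keeps-order {i = i} {q = xL i₂ ∷ q′} {w = w} {j = j} p su _ sw w⊑v x∈w y∈w b =
  Before-trans (IsShuf.unique sw) (IsShuf-ordered sw i<i₂ x∈w x₂∈w) x₂<y
  where
  y∈q′ : yL j ∈ q′
  y∈q′ with Before-middle⁻ p (IsShuf.unique su) b
  ... | there y∈ = y∈
  i<i₂ : i < i₂
  i<i₂ = x-Before⇒< su (Before-middle p (here refl))
  x₂∈w : xL i₂ ∈ w
  x₂∈w = decidable-stable (xL i₂ ∈? w) λ x₂∉w → w⊑v (lx i₂) x₂∉w (∈-insert p)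
  x₂<y : Before (xL i₂) (yL j) w
  x₂<y = decidable-stable (before? _≟ₗ_ _ _ w) λ ¬b → proj₂ (w⊑v (le i₂ j) (y∈w , ¬b)) (Before-middle p y∈q′)

delete-⋖ : ∀ p → IsShuf (p ++ xL i ∷ q) → IsShuf (p ++ q) → NotYHeaded q → (p ++ xL i ∷ q) ⋖ (p ++ q)
delete-⋖ {i = i} {q = q} p su sv nq = step⇒⋖ su sv (del p q i) squeeze
  where
  squeeze : ∀ w → IsShuf w → (p ++ xL i ∷ q) ⊑ w → w ⊑ (p ++ q) → w ⊑ (p ++ xL i ∷ q) ⊎ (p ++ q) ⊑ w
  squeeze w sw u⊑w w⊑v with xL i ∈? w
  ... | yes x∈w = inj₁ shrink
    where
    shrink : w ⊑ (p ++ xL i ∷ q)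
    shrink ℓ rw with xView i ℓ
    ... | at-x       = ⊥-elim (rw x∈w)
    ... | at-edge j  = ∈-addMiddle p (proj₁ (w⊑v (le i j) rw)) ,
                       proj₂ rw ∘ delete-keeps-order p su nq sw w⊑v x∈w (proj₁ rw)
    ... | away x∉ℓ   = Equivalence.to (Realised-addMiddle p ℓ x∉ℓ) (w⊑v ℓ rw)
  ... | no x∉w = inj₂ grow
    where
    grow : (p ++ q) ⊑ w
    grow ℓ rv with xView i ℓ
    ... | at-x      = x∉w
    ... | at-edge j = u⊑w (ly j) (∈-addMiddle p (proj₁ rv)) , x∉w ∘ Before⇒∈ˡ
    ... | away x∉ℓ  = u⊑w ℓ (Equivalence.to (Realised-addMiddle p ℓ x∉ℓ) rv)

-- In w, y_j precedes the letter y_{j₂} following it in v, which x_i does not precede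
-- in w because it does not in u.
insert-x-behind : ∀ p → IsShuf (p ++ q) → IsShuf (p ++ yL j ∷ q) → NotXHeaded q → IsShuf w →
                  (p ++ q) ⊑ w → yL j ∈ w → xL i ∈ q → ¬ Before (xL i) (yL j) w
insert-x-behind {q = xL _ ∷ _} p _ _ () _ _ _ _
insert-x-behind {q = yL j₂ ∷ q′} {j = j} {i = i} p su sv _ sw u⊑w y∈w (there x∈q′) b =
  proj₂ (u⊑w (le i j₂) (∈-insert p , x-not-first))
        (Before-trans (IsShuf.unique sw) b (IsShuf-ordered sw j<j₂ y∈w (u⊑w (ly j₂) (∈-insert p))))
  where
  x-not-first : ¬ Before (xL i) (yL j₂) (p ++ yL j₂ ∷ q′)
  x-not-first b′ = Before-asym (IsShuf.unique su) b′ (Before-middle p x∈q′)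
  j<j₂ : j < j₂
  j<j₂ = y-Before⇒< sv (Before-middle p (here refl))

insert-keeps-order : ∀ p → IsShuf (p ++ q) → IsShuf (p ++ yL j ∷ q) → NotXHeaded q → IsShuf w →
                     (p ++ q) ⊑ w → yL j ∈ w → Before (xL i) (yL j) w → Before (xL i) (yL j) (p ++ yL j ∷ q)
insert-keeps-order {q = q} {i = i} p su sv nq sw u⊑w y∈w b with ∈-++⁻ p x∈u
  where
  x∈u : xL i ∈ p ++ q
  x∈u = decidable-stable (xL i ∈? (p ++ q)) λ x∉u → u⊑w (lx i) x∉u (Before⇒∈ˡ b)
... | inj₁ x∈p = Before-middleˡ p x∈p
... | inj₂ x∈q = ⊥-elim (insert-x-behind p su sv nq sw u⊑w y∈w x∈q b)

insert-⋖ : ∀ p → IsShuf (p ++ q) → IsShuf (p ++ yL j ∷ q) → NotXHeaded q → (p ++ q) ⋖ (p ++ yL j ∷ q)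
insert-⋖ {q = q} {j = j} p su sv nq = step⇒⋖ su sv (ins p q j) squeeze
  where
  squeeze : ∀ w → IsShuf w → (p ++ q) ⊑ w → w ⊑ (p ++ yL j ∷ q) → w ⊑ (p ++ q) ⊎ (p ++ yL j ∷ q) ⊑ w
  squeeze w sw u⊑w w⊑v with yL j ∈? w
  ... | no y∉w = inj₁ shrink
    where
    shrink : w ⊑ (p ++ q)
    shrink ℓ rw with yView j ℓ
    ... | at-y      = ⊥-elim (y∉w rw)
    ... | at-edge _ = ⊥-elim (y∉w (proj₁ rw))
    ... | away y∉ℓ  = Equivalence.from (Realised-addMiddle p ℓ y∉ℓ) (w⊑v ℓ rw)
  ... | yes y∈w = inj₂ grow
    where
    grow : (p ++ yL j ∷ q) ⊑ w
    grow ℓ rv with yView j ℓ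
    ... | at-y      = y∈w
    ... | at-edge _ = y∈w , proj₂ rv ∘ insert-keeps-order p su sv nq sw u⊑w y∈w
    ... | away y∉ℓ  = u⊑w ℓ (Equivalence.from (Realised-addMiddle p ℓ y∉ℓ) rv)

-- Lower labels of a shuffle word

HeadAbove : Fin m → Word m n → Set
HeadAbove i []          = ⊤
HeadAbove i (xL i′ ∷ _) = i < i′
HeadAbove i (yL _ ∷ _)  = ⊥

HeadAbove⇒NotYHeaded : HeadAbove i q → NotYHeaded q
HeadAbove⇒NotYHeaded {q = []}       _ = tt
HeadAbove⇒NotYHeaded {q = xL _ ∷ _} _ = tt

splitAbove : ∀ i (w : Word m n) →
             ∃₂ λ p q → w ≡ p ++ q × (∀ {i′} → xL i′ ∈ p → ¬ i < i′) × HeadAbove i q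
splitAbove i [] = [] , [] , refl , (λ ()) , tt
splitAbove i (yL j ∷ w) with splitAbove i w
... | p , q , refl , below , above = yL j ∷ p , q , refl , (λ { (here ()) ; (there x∈) → below x∈ }) , above
splitAbove i (xL i′ ∷ w) with i <? i′
... | yes i<i′ = [] , xL i′ ∷ w , refl , (λ ()) , i<i′
... | no i≮i′ with splitAbove i w
...   | p , q , refl , below , above =
  xL i′ ∷ p , q , refl , (λ { (here refl) → i≮i′ ; (there x∈) → below x∈ }) , above

HeadAbove⇒above : ∀ p → IsShuf (p ++ q) → HeadAbove i q → xL i′ ∈ q → i < i′
HeadAbove⇒above {q = xL _ ∷ _} p _ i<i₁ (here refl) = i<i₁
HeadAbove⇒above {q = xL _ ∷ _} p s i<i₁ (there x∈)  = <-trans i<i₁ (x-Before⇒< s (Before-middle p x∈))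

-- x_i is inserted just before the first larger x, so no y follows it and deleting it
-- is a cover.
x-insertion-point : IsShuf v → xL i ∉ v → ∃₂ λ p q → v ≡ p ++ q × IsShuf (p ++ xL i ∷ q) × NotYHeaded q
x-insertion-point {v = v} {i = i} sv x∉v with splitAbove i v
... | p , q , refl , below , above =
  p , q , refl , mkIsShuf (Unique-addMiddle p x∉v (IsShuf.unique sv)) ordered , HeadAbove⇒NotYHeaded above
  where
  x-first : ∀ {b} → xL i ⊏ b → b ∈ p ++ q → Before (xL i) b (p ++ xL i ∷ q)
  x-first {xL _} i<b b∈ with ∈-++⁻ p b∈
  ... | inj₁ b∈p = ⊥-elim (below b∈p i<b)
  ... | inj₂ b∈q = Before-middle p b∈q
  x-last : ∀ {a} → a ⊏ xL i → a ∈ p ++ q → Before a (xL i) (p ++ xL i ∷ q)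
  x-last {xL _} a<i a∈ with ∈-++⁻ p a∈
  ... | inj₁ a∈p = Before-middleˡ p a∈p
  ... | inj₂ a∈q = ⊥-elim (<-asym a<i (HeadAbove⇒above p sv above a∈q))
  ordered : ∀ {a b} → a ⊏ b → a ∈ p ++ xL i ∷ q → b ∈ p ++ xL i ∷ q → Before a b (p ++ xL i ∷ q)
  ordered a⊏b a∈ b∈ with ∈-middle⁻ p a∈ | ∈-middle⁻ p b∈
  ... | inj₁ refl | inj₁ refl = ⊥-elim (<-irrefl refl a⊏b)
  ... | inj₁ refl | inj₂ b∈v  = x-first a⊏b b∈v
  ... | inj₂ a∈v  | inj₁ refl = x-last a⊏b a∈v
  ... | inj₂ a∈v  | inj₂ b∈v  = Before-addMiddle p (IsShuf-ordered sv a⊏b a∈v b∈v)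

DescentLabel : Word m n → Label m n → Set
DescentLabel v (lx i)   = xL i ∉ v
DescentLabel v (ly j)   = ∃₂ λ p q → v ≡ p ++ yL j ∷ q × NotXHeaded q
DescentLabel v (le i j) = Adjacent (yL j) (xL i) v

insert-⋖⇒NotXHeaded : ∀ (p q : Word m n) → IsShuf (p ++ q) → IsShuf (p ++ yL j ∷ q) →
                      (p ++ q) ⋖ (p ++ yL j ∷ q) → NotXHeaded q
insert-⋖⇒NotXHeaded p []         _ _ _ = tt
insert-⋖⇒NotXHeaded p (yL _ ∷ _) _ _ _ = tt
insert-⋖⇒NotXHeaded {m = m} {n = n} {j = j} p (xL i ∷ r) su sv (_ , _ , between) =
  [ mid≢u , mid≢v ]′ (between mid smid (u→mid ◅ ε) (mid→v ◅ ε))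
  where
  mid : Word m n
  mid = p ++ xL i ∷ yL j ∷ r
  smid : IsShuf mid
  smid = IsShuf-swapMiddle p (λ ()) sv
  u→mid : Move (p ++ xL i ∷ r) mid
  u→mid = su , smid , ly j , subst₂ (λ a b → Step a (ly j) b)
          (++-assoc p [ xL i ] r) (++-assoc p [ xL i ] (yL j ∷ r)) (ins (p ++ [ xL i ]) r j)
  mid→v : Move mid (p ++ yL j ∷ xL i ∷ r)
  mid→v = smid , sv , le i j , swap p r i j
  mid≢u : mid ≢ p ++ xL i ∷ r
  mid≢u e = Unique-middle-∉ p (IsShuf.unique sv) (subst (yL j ∈_) e (∈-++⁺ʳ p (there (here refl))))
  mid≢v : mid ≢ p ++ yL j ∷ xL i ∷ r
  mid≢v e with ++-cancelˡ p _ _ e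
  ... | ()

LabelDown⇒DescentLabel : IsShuf v → LabelDown v ℓ → DescentLabel v ℓ
LabelDown⇒DescentLabel _  (_ , su , _   , del p q _)    = Unique-middle-∉ p (IsShuf.unique su)
LabelDown⇒DescentLabel sv (_ , su , u⋖v , ins p q _)    = p , q , refl , insert-⋖⇒NotXHeaded p q su sv u⋖v
LabelDown⇒DescentLabel _  (_ , _  , _   , swap p q _ _) = p , q , refl

DescentLabel⇒LabelDown : ∀ ℓ → IsShuf v → DescentLabel v ℓ → LabelDown v ℓ
DescentLabel⇒LabelDown (lx i) sv x∉v with x-insertion-point sv x∉v
... | p , q , refl , su , nq = p ++ xL i ∷ q , su , delete-⋖ p su sv nq , del p q i
DescentLabel⇒LabelDown (ly j) sv (p , q , refl , nq) =
  p ++ q , su , insert-⋖ p su sv nq , ins p q j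
  where
  su : IsShuf (p ++ q)
  su = IsShuf-dropMiddle p sv
DescentLabel⇒LabelDown (le i j) sv (p , q , refl) =
  p ++ xL i ∷ yL j ∷ q , su , swap-⋖ p su sv , swap p q i j
  where
  su : IsShuf (p ++ xL i ∷ yL j ∷ q)
  su = IsShuf-swapMiddle p (λ ()) sv

LabelDown⇔DescentLabel : ∀ ℓ → IsShuf v → LabelDown v ℓ ⇔ DescentLabel v ℓ
LabelDown⇔DescentLabel ℓ sv = mk⇔ (LabelDown⇒DescentLabel sv) (DescentLabel⇒LabelDown ℓ sv)

-- Lower-label sets are faces

descent-shared-letter : ∀ ℓ ℓ′ → IsShuf v → DescentLabel v ℓ → DescentLabel v ℓ′ →
                        a ∈ lettersOf ℓ → a ∈ lettersOf ℓ′ → ℓ ≡ ℓ′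
descent-shared-letter (lx _)   (lx _)   _  _  _  (here refl) (here refl) = refl
descent-shared-letter (lx _)   (ly _)   _  _  _  (here refl) (here ())
descent-shared-letter (lx _)   (le _ _) _  x∉ a  (here refl) (here refl) = ⊥-elim (x∉ (Before⇒∈ʳ (Adjacent⇒Before a)))
descent-shared-letter (lx _)   (le _ _) _  _  _  (here refl) (there (here ()))
descent-shared-letter (ly _)   (lx _)   _  _  _  (here refl) (here ())
descent-shared-letter (ly _)   (ly _)   _  _  _  (here refl) (here refl) = refl
descent-shared-letter (ly _)   (le _ _) _  _  _  (here refl) (here ())
descent-shared-letter (ly _)   (le _ _) sv (p , _ , e , nq) (p′ , _ , e′) (here refl) (there (here refl))
  with unique-split p p′ (IsShuf.unique sv) e e′
... | _ , refl = ⊥-elim nq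
descent-shared-letter (le _ _) (lx _)   _  a  x∉ (here refl) (here refl) = ⊥-elim (x∉ (Before⇒∈ʳ (Adjacent⇒Before a)))
descent-shared-letter (le _ _) (lx _)   _  _  _  (there (here ())) (here refl)
descent-shared-letter (le _ _) (ly _)   _  _  _  (here ()) (here refl)
descent-shared-letter (le _ _) (ly _)   sv (p′ , _ , e′) (p , _ , e , nq) (there (here refl)) (here refl)
  with unique-split p p′ (IsShuf.unique sv) e e′
... | _ , refl = ⊥-elim nq
descent-shared-letter (le i _) (le _ _) sv a a′ (here refl) (here refl) =
  cong (le i) (yL-injective (Adjacent-predecessor (IsShuf.unique sv) a a′))
descent-shared-letter (le _ _) (le _ _) _  _ _  (here refl) (there (here ()))
descent-shared-letter (le _ _) (le _ _) _  _ _  (there (here ())) (here refl)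
descent-shared-letter (le _ j) (le _ _) sv a a′ (there (here refl)) (there (here refl)) =
  cong (λ i → le i j) (xL-injective (Adjacent-successor (IsShuf.unique sv) a a′))

descent-noncrossing : IsShuf v → Adjacent (yL j) (xL i) v → Adjacent (yL j′) (xL i′) v → i < i′ → j < j′
descent-noncrossing {v = v} {j = j} {i = i} {j′ = j′} {i′ = i′} sv a a′ i<i′ with j ≟ j′
... | yes refl = ⊥-elim (<-irrefl (xL-injective (Adjacent-successor (IsShuf.unique sv) a a′)) i<i′)
... | no j≢j′  = y-Before⇒< sv (Before-adjacent (IsShuf.unique sv) a′ (j≢j′ ∘ yL-injective) y<x′)
  where
  y<x′ : Before (yL j) (xL i′) v
  y<x′ = Before-trans (IsShuf.unique sv) (Adjacent⇒Before a)
           (IsShuf-ordered sv i<i′ (Before⇒∈ʳ (Adjacent⇒Before a)) (Before⇒∈ʳ (Adjacent⇒Before a′)))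

descent-face : IsShuf v → (∀ ℓ → T (σ ℓ) → DescentLabel v ℓ) → IsFace σ
descent-face sv descent = record
  { atMostOnce  = λ ℓ ℓ′ s s′ ℓ≢ℓ′ _ a∈ a∈′ →
                    ℓ≢ℓ′ (descent-shared-letter ℓ ℓ′ sv (descent ℓ s) (descent ℓ′ s′) a∈ a∈′)
  ; noncrossing = λ s₁ t₁ s₂ t₂ e₁ e₂ →
                    descent-noncrossing sv (descent (le s₁ t₁) e₁) (descent (le s₂ t₂) e₂)
  }

-- Every face is a lower-label set

Interleaves : List (Fin m) → List (Fin n) → Word m n → Set
Interleaves = Interleaving (λ i a → xL i ≡ a) (λ j a → yL j ≡ a)

private
  variable
    xs : List (Fin m)
    ys : List (Fin n)

Interleaves-∈ˣ⁻ : Interleaves xs ys w → xL i ∈ w → i ∈ xs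
Interleaves-∈ˣ⁻ (refl ∷ˡ _)  (here e)   = here (xL-injective e)
Interleaves-∈ˣ⁻ (refl ∷ˡ it) (there x∈) = there (Interleaves-∈ˣ⁻ it x∈)
Interleaves-∈ˣ⁻ (refl ∷ʳ it) (there x∈) = Interleaves-∈ˣ⁻ it x∈

Interleaves-∈ˣ⁺ : Interleaves xs ys w → i ∈ xs → xL i ∈ w
Interleaves-∈ˣ⁺ (refl ∷ˡ _)  (here refl) = here refl
Interleaves-∈ˣ⁺ (refl ∷ˡ it) (there i∈)  = there (Interleaves-∈ˣ⁺ it i∈)
Interleaves-∈ˣ⁺ (refl ∷ʳ it) i∈          = there (Interleaves-∈ˣ⁺ it i∈)

Interleaves-∈ʸ⁻ : Interleaves xs ys w → yL j ∈ w → j ∈ ys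
Interleaves-∈ʸ⁻ (refl ∷ʳ _)  (here e)   = here (yL-injective e)
Interleaves-∈ʸ⁻ (refl ∷ʳ it) (there y∈) = there (Interleaves-∈ʸ⁻ it y∈)
Interleaves-∈ʸ⁻ (refl ∷ˡ it) (there y∈) = Interleaves-∈ʸ⁻ it y∈

Interleaves-∈ʸ⁺ : Interleaves xs ys w → j ∈ ys → yL j ∈ w
Interleaves-∈ʸ⁺ (refl ∷ʳ _)  (here refl) = here refl
Interleaves-∈ʸ⁺ (refl ∷ʳ it) (there j∈)  = there (Interleaves-∈ʸ⁺ it j∈)
Interleaves-∈ʸ⁺ (refl ∷ˡ it) j∈          = there (Interleaves-∈ʸ⁺ it j∈)

Interleaves-IsShuf : AllPairs _<_ xs → AllPairs _<_ ys → Interleaves xs ys w → IsShuf w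
Interleaves-IsShuf sx sy it = mkIsShuf (unique sx sy it) (ordered sx sy it)
  where
  unique : AllPairs _<_ xs → AllPairs _<_ ys → Interleaves xs ys w → Unique w
  unique _           _           []           = []
  unique (x< ∷ sx)   sy          (refl ∷ˡ it) =
    All.tabulate (λ { x∈ refl → <-irrefl refl (All.lookup x< (Interleaves-∈ˣ⁻ it x∈)) }) ∷ unique sx sy it
  unique sx          (y< ∷ sy)   (refl ∷ʳ it) =
    All.tabulate (λ { y∈ refl → <-irrefl refl (All.lookup y< (Interleaves-∈ʸ⁻ it y∈)) }) ∷ unique sx sy it
  ordered : AllPairs _<_ xs → AllPairs _<_ ys → Interleaves xs ys w →
            a ⊏ b → a ∈ w → b ∈ w → Before a b w
  ordered _         _         (refl ∷ˡ _)  x<x (here refl) (here refl) = ⊥-elim (<-irrefl refl x<x)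
  ordered _         _         (refl ∷ˡ _)  _   (here refl) (there b∈) = here b∈
  ordered {a = xL _} (x< ∷ _) _ (refl ∷ˡ it) a<x (there a∈) (here refl) =
    ⊥-elim (<-asym a<x (All.lookup x< (Interleaves-∈ˣ⁻ it a∈)))
  ordered {a = yL _} _ _ (refl ∷ˡ _) () (there _) (here refl)
  ordered (_ ∷ sx)  sy        (refl ∷ˡ it) a⊏b (there a∈) (there b∈) = there (ordered sx sy it a⊏b a∈ b∈)
  ordered _         _         (refl ∷ʳ _)  y<y (here refl) (here refl) = ⊥-elim (<-irrefl refl y<y)
  ordered _         _         (refl ∷ʳ _)  _   (here refl) (there b∈) = here b∈
  ordered {a = yL _} _ (y< ∷ _) (refl ∷ʳ it) a<y (there a∈) (here refl) =
    ⊥-elim (<-asym a<y (All.lookup y< (Interleaves-∈ʸ⁻ it a∈)))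
  ordered {a = xL _} _ _ (refl ∷ʳ _) () (there _) (here refl)
  ordered sx        (_ ∷ sy)  (refl ∷ʳ it) a⊏b (there a∈) (there b∈) = there (ordered sx sy it a⊏b a∈ b∈)

le-injective : le {m} {n} i j ≡ le i′ j′ → i ≡ i′ × j ≡ j′
le-injective refl = refl , refl

module FaceWord {m n : ℕ} (σ : Subset m n) (face : IsFace σ) where
  open IsFace face

  private
    variable
      x : Fin m
      y : Fin n

  edge-x-unique : T (σ (le i j)) → T (σ (le i j′)) → j ≡ j′
  edge-x-unique {i = i} {j = j} {j′ = j′} s s′ with j ≟ j′
  ... | yes j≡j′ = j≡j′
  ... | no j≢j′  = ⊥-elim (atMostOnce (le i j) (le i j′) s s′ (j≢j′ ∘ proj₂ ∘ le-injective)
                             (xL i) (here refl) (here refl))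

  edge-y-unique : T (σ (le i j)) → T (σ (le i′ j)) → i ≡ i′
  edge-y-unique {i = i} {j = j} {i′ = i′} s s′ with i ≟ i′
  ... | yes i≡i′ = i≡i′
  ... | no i≢i′  = ⊥-elim (atMostOnce (le i j) (le i′ j) s s′ (i≢i′ ∘ proj₁ ∘ le-injective)
                             (yL j) (there (here refl)) (there (here refl)))

  lx-edge-disjoint : T (σ (lx i)) → ¬ T (σ (le i j))
  lx-edge-disjoint s s′ = atMostOnce (lx _) (le _ _) s s′ (λ ()) (xL _) (here refl) (here refl)

  ly-edge-disjoint : T (σ (ly j)) → ¬ T (σ (le i j))
  ly-edge-disjoint s s′ = atMostOnce (ly _) (le _ _) s s′ (λ ()) (yL _) (here refl) (there (here refl))

  Matched : Fin m → Set
  Matched i = Any (λ j → T (σ (le i j))) (allFin n)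

  matched? : ∀ i → Dec (Matched i)
  matched? i = any? (λ j → T? (σ (le i j))) (allFin n)

  -- Edges of σ are emitted as factors y_j x_i; a lone y overtakes the pending x only
  -- while that x waits for a later partner, so no y is directly followed by an x
  -- outside an edge.
  merge : List (Fin m) → List (Fin n) → Word m n
  merge []       ys       = map yL ys
  merge (x ∷ xs) []       = xL x ∷ merge xs []
  merge (x ∷ xs) (y ∷ ys) =
    if σ (le x y) then yL y ∷ xL x ∷ merge xs ys
    else if does (matched? x) then yL y ∷ merge (x ∷ xs) ys
    else xL x ∷ merge xs (y ∷ ys)

  merge-interleaves : ∀ xs ys → Interleaves xs ys (merge xs ys)
  merge-interleaves = List-ind₂ (λ xs ys → Interleaves xs ys (merge xs ys)) nil (refl ∷ˡ_) step
    where
    nil : ∀ ys → Interleaves [] ys (merge [] ys)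
    nil []       = []
    nil (y ∷ ys) = refl ∷ʳ nil ys
    step : Interleaves xs ys (merge xs ys) → Interleaves (x ∷ xs) ys (merge (x ∷ xs) ys) →
           Interleaves xs (y ∷ ys) (merge xs (y ∷ ys)) → Interleaves (x ∷ xs) (y ∷ ys) (merge (x ∷ xs) (y ∷ ys))
    step {x = x} {y = y} i₁ i₂ i₃ with σ (le x y) | matched? x
    ... | true  | _     = refl ∷ʳ refl ∷ˡ i₁
    ... | false | yes _ = refl ∷ʳ i₂
    ... | false | no _  = refl ∷ˡ i₃

  record MergeInv (xs : List (Fin m)) (ys : List (Fin n)) : Set where
    field
      xs-sorted : AllPairs _<_ xs
      ys-sorted : AllPairs _<_ ys
      partners  : ∀ {i j} → i ∈ xs → T (σ (le i j)) → j ∈ ys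
  open MergeInv

  MergeInv-dropˣ : MergeInv (x ∷ xs) ys → MergeInv xs ys
  MergeInv-dropˣ I = record
    { xs-sorted = AllPairs.tail (xs-sorted I) ; ys-sorted = ys-sorted I ; partners = partners I ∘ there }

  MergeInv-dropʸ : (∀ {i} → i ∈ xs → ¬ T (σ (le i y))) → MergeInv xs (y ∷ ys) → MergeInv xs ys
  MergeInv-dropʸ {xs = xs} {ys = ys} unpartnered I = record
    { xs-sorted = xs-sorted I ; ys-sorted = AllPairs.tail (ys-sorted I) ; partners = partners′ }
    where
    partners′ : ∀ {i j} → i ∈ xs → T (σ (le i j)) → j ∈ ys
    partners′ i∈ s with partners I i∈ s
    ... | here refl = ⊥-elim (unpartnered i∈ s)
    ... | there j∈  = j∈

  edge-step : T (σ (le x y)) → MergeInv (x ∷ xs) (y ∷ ys) → MergeInv xs ys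
  edge-step s I = MergeInv-dropʸ
    (λ i∈ s′ → <-irrefl (edge-y-unique s s′) (All.lookup (AllPairs.head (xs-sorted I)) i∈))
    (MergeInv-dropˣ I)

  waiting-step : σ (le x y) ≡ false → Matched x → MergeInv (x ∷ xs) (y ∷ ys) → MergeInv (x ∷ xs) ys
  waiting-step {x = x} {y = y} {xs = xs} e mx I = MergeInv-dropʸ unpartnered I
    where
    unpartnered : ∀ {i} → i ∈ x ∷ xs → ¬ T (σ (le i y))
    unpartnered (here refl) s = subst T e s
    unpartnered (there i∈) s′ with satisfied mx
    ... | _ , s with partners I (here refl) s
    ...   | here refl = subst T e s
    ...   | there t∈  = <-asym (All.lookup (AllPairs.head (ys-sorted I)) t∈)
                          (noncrossing _ _ _ _ s s′ (All.lookup (AllPairs.head (xs-sorted I)) i∈))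

  merge-NotXHeaded : Matched x → MergeInv (x ∷ xs) ys → NotXHeaded (merge (x ∷ xs) ys)
  merge-NotXHeaded {ys = []} mx I with satisfied mx
  ... | _ , s with partners I (here refl) s
  ...   | ()
  merge-NotXHeaded {x = x} {ys = y ∷ ys} mx I with σ (le x y) | matched? x
  ... | true  | _      = tt
  ... | false | yes _  = tt
  ... | false | no ¬mx = ⊥-elim (¬mx mx)

  Compatible : Letter m n → Letter m n → Set
  Compatible (yL j) (xL i) = T (σ (le i j))
  Compatible _      _      = ⊤

  xL-∷-Compatible : Linked Compatible w → Linked Compatible (xL i ∷ w)
  xL-∷-Compatible {w = []}    _ = [-]
  xL-∷-Compatible {w = _ ∷ _} l = tt ∷ l

  yL-∷-Compatible : NotXHeaded w → Linked Compatible w → Linked Compatible (yL j ∷ w)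
  yL-∷-Compatible {w = []}       _ _ = [-]
  yL-∷-Compatible {w = yL _ ∷ _} _ l = tt ∷ l

  map-yL-Compatible : ∀ ys → Linked Compatible (map yL ys)
  map-yL-Compatible []           = []
  map-yL-Compatible (_ ∷ [])     = [-]
  map-yL-Compatible (_ ∷ y ∷ ys) = tt ∷ map-yL-Compatible (y ∷ ys)

  merge-Compatible : MergeInv xs ys → Linked Compatible (merge xs ys)
  merge-Compatible = List-ind₂ P (λ ys _ → map-yL-Compatible ys)
    (λ l I → xL-∷-Compatible (l (MergeInv-dropˣ I))) step _ _
    where
    P : List (Fin m) → List (Fin n) → Set
    P xs ys = MergeInv xs ys → Linked Compatible (merge xs ys)
    step : P xs ys → P (x ∷ xs) ys → P xs (y ∷ ys) → P (x ∷ xs) (y ∷ ys)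
    step {x = x} {y = y} l₁ l₂ l₃ I with σ (le x y) in e | matched? x
    ... | true  | _    = Equivalence.from T-≡ e ∷ xL-∷-Compatible (l₁ (edge-step (Equivalence.from T-≡ e) I))
    ... | false | yes mx =
      yL-∷-Compatible (merge-NotXHeaded mx (waiting-step e mx I)) (l₂ (waiting-step e mx I))
    ... | false | no _ = xL-∷-Compatible (l₃ (MergeInv-dropˣ I))

  merge-edge-adjacent : MergeInv xs ys → i ∈ xs → T (σ (le i j)) → Adjacent (yL j) (xL i) (merge xs ys)
  merge-edge-adjacent I = List-ind₂ P (λ _ _ ()) (λ _ I i∈ s → absurd (partners I i∈ s)) step _ _ I
    where
    absurd : j ∈ [] → Adjacent (yL j) (xL i) w
    absurd ()
    P : List (Fin m) → List (Fin n) → Set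
    P xs ys = MergeInv xs ys → ∀ {i j} → i ∈ xs → T (σ (le i j)) → Adjacent (yL j) (xL i) (merge xs ys)
    step : P xs ys → P (x ∷ xs) ys → P xs (y ∷ ys) → P (x ∷ xs) (y ∷ ys)
    step {x = x} {y = y} a₁ a₂ a₃ I i∈ s with σ (le x y) in e | matched? x | i∈
    ... | true  | _      | here refl with edge-x-unique (Equivalence.from T-≡ e) s
    ...   | refl = [] , _ , refl
    step a₁ a₂ a₃ I i∈ s | true  | _      | there i∈′ =
      Adjacent-there (Adjacent-there (a₁ (edge-step (Equivalence.from T-≡ e) I) i∈′ s))
    step a₁ a₂ a₃ I i∈ s | false | yes mx | _ = Adjacent-there (a₂ (waiting-step e mx I) i∈ s)
    step a₁ a₂ a₃ I i∈ s | false | no ¬mx | here refl = ⊥-elim (¬mx (lose (∈-allFin _) s))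
    step a₁ a₂ a₃ I i∈ s | false | no _   | there i∈′ = Adjacent-there (a₃ (MergeInv-dropˣ I) i∈′ s)

  keep? : ∀ i → Dec (¬ T (σ (lx i)))
  keep? i = ¬? (T? (σ (lx i)))

  insert? : ∀ j → Dec (T (σ (ly j)) ⊎ Any (λ i → T (σ (le i j))) (allFin m))
  insert? j = T? (σ (ly j)) ⊎-dec any? (λ i → T? (σ (le i j))) (allFin m)

  kept : List (Fin m)
  kept = filter keep? (allFin m)

  inserted : List (Fin n)
  inserted = filter insert? (allFin n)

  kept-edge : T (σ (le i j)) → i ∈ kept
  kept-edge {i = i} s = ∈-filter⁺ keep? (∈-allFin i) (λ s′ → lx-edge-disjoint s′ s)

  merge-inv : MergeInv kept inserted
  merge-inv = record
    { xs-sorted = AllPairsₚ.filter⁺ keep? (AllPairsₚ.tabulate⁺-< id)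
    ; ys-sorted = AllPairsₚ.filter⁺ insert? (AllPairsₚ.tabulate⁺-< id)
    ; partners  = λ {i} {j} _ s → ∈-filter⁺ insert? (∈-allFin j) (inj₂ (lose (∈-allFin i) s))
    }

  word : Word m n
  word = merge kept inserted

  word-interleaves : Interleaves kept inserted word
  word-interleaves = merge-interleaves kept inserted

  word-IsShuf : IsShuf word
  word-IsShuf = Interleaves-IsShuf (xs-sorted merge-inv) (ys-sorted merge-inv) word-interleaves

  σ⇔descent : ∀ ℓ → T (σ ℓ) ⇔ DescentLabel word ℓ
  σ⇔descent (lx i) = mk⇔
    (λ s x∈ → proj₂ (∈-filter⁻ keep? {xs = allFin m} (Interleaves-∈ˣ⁻ word-interleaves x∈)) s)
    (λ x∉ → decidable-stable (T? _) λ ¬s → x∉ (Interleaves-∈ˣ⁺ word-interleaves (∈-filter⁺ keep? (∈-allFin i) ¬s)))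
  σ⇔descent (ly j) = mk⇔ to from
    where
    to : T (σ (ly j)) → DescentLabel word (ly j)
    to s with ∈-∃++ (Interleaves-∈ʸ⁺ word-interleaves (∈-filter⁺ insert? (∈-allFin j) (inj₁ s)))
    ... | p , q , e = p , q , e , not-x q e
      where
      not-x : ∀ q → word ≡ p ++ yL j ∷ q → NotXHeaded q
      not-x []         _ = tt
      not-x (yL _ ∷ _) _ = tt
      not-x (xL _ ∷ q) e = ly-edge-disjoint s (Linked-adjacent (merge-Compatible merge-inv) (p , q , e))
    from : DescentLabel word (ly j) → T (σ (ly j))
    from (p , q , e , nq) with proj₂ (∈-filter⁻ insert? {xs = allFin n} (Interleaves-∈ʸ⁻ word-interleaves y∈))
      where
      y∈ : yL j ∈ word
      y∈ = subst (yL j ∈_) (sym e) (∈-insert p)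
    ... | inj₁ s = s
    ... | inj₂ matched with satisfied matched
    ...   | _ , s with merge-edge-adjacent merge-inv (kept-edge s) s
    ...     | p′ , _ , e′ with unique-split p p′ (IsShuf.unique word-IsShuf) e e′
    ...       | _ , refl = ⊥-elim nq
  σ⇔descent (le i j) = mk⇔ (λ s → merge-edge-adjacent merge-inv (kept-edge s) s)
                           (Linked-adjacent (merge-Compatible merge-inv))

face⇒descent-word : IsFace σ → ∃ λ v → IsShuf v × (∀ ℓ → T (σ ℓ) ⇔ DescentLabel v ℓ)
face⇒descent-word {σ = σ} face = word , word-IsShuf , σ⇔descent
  where open FaceWord σ face

proposition3p1 : ∀ (m n : ℕ) (σ : Subset m n) →
    IsFace σ ⇔ (∃ λ (v : Word m n) → IsShuf v × (∀ ℓ → T (σ ℓ) ⇔ LabelDown v ℓ))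
proposition3p1 m n σ = mk⇔ face⇒word word⇒face
  where
  face⇒word : IsFace σ → ∃ λ (v : Word m n) → IsShuf v × (∀ ℓ → T (σ ℓ) ⇔ LabelDown v ℓ)
  face⇒word face with face⇒descent-word face
  ... | v , sv , σ⇔descent = v , sv , λ ℓ → ⇔-sym (LabelDown⇔DescentLabel ℓ sv) ⇔-∘ σ⇔descent ℓ
  word⇒face : (∃ λ (v : Word m n) → IsShuf v × (∀ ℓ → T (σ ℓ) ⇔ LabelDown v ℓ)) → IsFace σ
  word⇒face (v , sv , σ⇔labels) =
    descent-face sv λ ℓ s → LabelDown⇒DescentLabel sv (Equivalence.to (σ⇔labels ℓ) s)
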